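{- For $k\ge 4$, let $H_k$ be the wheel $W_{k+1}=C_k\vee K_1$. Then $\mathcal{I}(\overline{H_k})\cong\mathcal{A}(\overline{H_k})\cong C_k$.
   Context: $\overline{H}$ denotes the complement of $H$; $\vee$ denotes the join. For a graph $G$, an $i$-set is an independent dominating set of minimum cardinality and an $\alpha$-set is a maximum independent set. The $i$-graph $\mathcal{I}(G)$ has the $i$-sets as vertices, with $X\sim Y$ iff $Y=(X\setminus\{u\})\cup\{v\}$ for some $u\in X$, $v\notin X$ with $uv\in E(G)$; the $\alpha$-graph $\mathcal{A}(G)$ is defined the same way on the $\alpha$-sets. -}

module Defs where

open import Data.Nat using (ℕ; zero; suc; _≤_)
open import Data.Fin using (Fin; toℕ)
import Data.Fin as F
open import Data.Fin.Subset using (Subset; _∈_; _∉_; ∣_∣; inside; outside)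
open import Data.Vec using (_[_]≔_)
open import Data.Product using (Σ; ∃; _×_)
open import Data.Sum using (_⊎_)
open import Data.Empty using (⊥)
open import Data.Unit using (⊤)
open import Relation.Nullary using (¬_)
open import Relation.Binary.PropositionalEquality using (_≡_; _≢_)

Graph : ℕ → Set₁
Graph n = Fin n → Fin n → Set

complement : ∀ {n} → Graph n → Graph n
complement G x y = (x ≢ y) × ¬ G x y

cycleAdj : (k : ℕ) → Graph k
cycleAdj k i j =
  (toℕ j ≡ suc (toℕ i)) ⊎ (toℕ i ≡ suc (toℕ j))
  ⊎ ((toℕ i ≡ 0) × (suc (toℕ j) ≡ k))
  ⊎ ((toℕ j ≡ 0) × (suc (toℕ i) ≡ k))

-- The wheel W_{k+1} = C_k ∨ K_1 on Fin (suc k): vertex zero is the hub,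
-- vertex suc i is the cycle vertex i.
wheel : (k : ℕ) → Graph (suc k)
wheel k F.zero F.zero = ⊥
wheel k F.zero (F.suc j) = ⊤
wheel k (F.suc i) F.zero = ⊤
wheel k (F.suc i) (F.suc j) = cycleAdj k i j

module _ {n : ℕ} (G : Graph n) where

  Independent : Subset n → Set
  Independent S = ∀ x y → x ∈ S → y ∈ S → ¬ G x y

  Dominating : Subset n → Set
  Dominating S = ∀ x → x ∈ S ⊎ (∃ λ y → y ∈ S × G x y)

  IsISet : Subset n → Set
  IsISet S = Independent S × Dominating S
    × (∀ T → Independent T → Dominating T → ∣ S ∣ ≤ ∣ T ∣)

  IsAlphaSet : Subset n → Set
  IsAlphaSet S = Independent S × (∀ T → Independent T → ∣ T ∣ ≤ ∣ S ∣)

  Jump : Subset n → Subset n → Set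
  Jump X Y = ∃ λ u → ∃ λ v → u ∈ X × v ∉ X × G u v
    × (Y ≡ ((X [ u ]≔ outside) [ v ]≔ inside))

IsoTo : ∀ {m n} → Graph m → (Subset n → Set) → (Subset n → Subset n → Set) → Set
IsoTo {m} {n} A P R = Σ (Fin m → Subset n) λ φ →
    (∀ i → P (φ i))
  × (∀ i j → φ i ≡ φ j → i ≡ j)
  × (∀ S → P S → ∃ λ i → φ i ≡ S)
  × (∀ i j → (A i j → R (φ i) (φ j)) × (R (φ i) (φ j) → A i j))

-- Independent sets of the complement of a graph are its cliques. Since C_k is
-- triangle-free for k ≥ 4, every clique of the wheel lies in one of the k
-- triangles {hub, i, i+1}; these all have three vertices, so they are exactly
-- the maximal and the maximum cliques, i.e. both the i-sets and the α-sets of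
-- the complement. A token jump between two such triangles keeps the hub and
-- one rim vertex, and two distinct triangles share a rim vertex exactly when
-- their indices are consecutive on C_k.
module Submission where

open import Defs
open import Data.Empty using (⊥; ⊥-elim)
open import Data.Unit using (tt)
open import Data.Fin using (Fin; zero; suc; toℕ; lower₁)
open import Data.Fin.Properties using (toℕ-injective; toℕ<n; toℕ-lower₁; suc-injective; any?)
  renaming (_≟_ to _≟ᶠ_)
open import Data.Fin.Subset using (Subset; _∈_; _∉_; _⊆_; ∣_∣; inside; outside; ⁅_⁆)
open import Data.Fin.Subset.Properties
  using (_∈?_; ⊆-antisym; p⊆q⇒∣p∣≤∣q∣; p⊂q⇒∣p∣<∣q∣; x∈⁅y⁆⇒x≡y; x∈⁅x⁆; ∣⁅x⁆∣≡1)
open import Data.Nat using (ℕ; _≤_; _<_; z≤n; s≤s)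
import Data.Nat as ℕ
open import Data.Nat.Properties using (<-irrefl; ≤-trans; ≤-reflexive; <-≤-trans)
open import Data.Product using (_×_; _,_; ∃)
open import Data.Sum using (_⊎_; inj₁; inj₂)
open import Data.Vec using (_∷_; _[_]≔_; here; there)
open import Data.Vec.Properties
  using ([]=-injective; []≔-updates; []≔-minimal; []=⇒lookup; lookup⇒[]=; lookup∘updateAt′)
open import Function using (_∘_)
open import Relation.Binary.Definitions using (Decidable; Symmetric)
open import Relation.Binary.PropositionalEquality
open import Relation.Nullary using (¬_; yes; no)
open import Relation.Nullary.Decidable using (¬?; _×-dec_; _⊎-dec_; decidable-stable)

module _ {n : ℕ} {x : Fin n} where

  ∈-[]≔⁻ : ∀ {p y b} → x ≢ y → x ∈ p [ y ]≔ b → x ∈ p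
  ∈-[]≔⁻ {p} {y} x≢y x∈ = lookup⇒[]= x p (trans (sym (lookup∘updateAt′ x y x≢y p)) ([]=⇒lookup x∈))

  ∈-[]≔inside⁻ : ∀ {p y} → x ∈ p [ y ]≔ inside → x ≡ y ⊎ x ∈ p
  ∈-[]≔inside⁻ {y = y} x∈ with x ≟ᶠ y
  ... | yes x≡y = inj₁ x≡y
  ... | no x≢y = inj₂ (∈-[]≔⁻ x≢y x∈)

  ∈-[]≔outside⁻ : ∀ {p y} → x ∈ p [ y ]≔ outside → x ≢ y × x ∈ p
  ∈-[]≔outside⁻ {p} {y} x∈ with x ≟ᶠ y
  ... | yes refl with () ← []=-injective x∈ ([]≔-updates p x)
  ... | no x≢y = x≢y , ∈-[]≔⁻ x≢y x∈

  ∈-swap⁻ : ∀ {p u v} → x ∈ (p [ u ]≔ outside) [ v ]≔ inside → x ≡ v ⊎ (x ≢ u × x ∈ p)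
  ∈-swap⁻ x∈ with ∈-[]≔inside⁻ x∈
  ... | inj₁ x≡v = inj₁ x≡v
  ... | inj₂ x∈′ = inj₂ (∈-[]≔outside⁻ x∈′)

  ∈-swap⁺ : ∀ {p u v} → x ≡ v ⊎ (x ≢ u × x ∈ p) → x ∈ (p [ u ]≔ outside) [ v ]≔ inside
  ∈-swap⁺ (inj₁ refl) = []≔-updates _ x
  ∈-swap⁺ {p} {u} {v} (inj₂ (x≢u , x∈p)) with x ≟ᶠ v
  ... | yes refl = []≔-updates _ x
  ... | no x≢v = []≔-minimal _ x v x≢v ([]≔-minimal p x u x≢u x∈p)

swap-keeps : ∀ {n} {X Y : Subset n} {u v x} →
  Y ≡ (X [ u ]≔ outside) [ v ]≔ inside → x ≢ u → x ∈ X → x ∈ Y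
swap-keeps refl x≢u x∈X = ∈-swap⁺ (inj₂ (x≢u , x∈X))

∣p[x]≔inside∣≡1+∣p∣ : ∀ {n} (p : Subset n) {x} → x ∉ p → ∣ p [ x ]≔ inside ∣ ≡ ℕ.suc ∣ p ∣
∣p[x]≔inside∣≡1+∣p∣ (inside ∷ p) {zero} x∉p = ⊥-elim (x∉p here)
∣p[x]≔inside∣≡1+∣p∣ (outside ∷ p) {zero} x∉p = refl
∣p[x]≔inside∣≡1+∣p∣ (inside ∷ p) {suc x} x∉p = cong ℕ.suc (∣p[x]≔inside∣≡1+∣p∣ p (x∉p ∘ there))
∣p[x]≔inside∣≡1+∣p∣ (outside ∷ p) {suc x} x∉p = ∣p[x]≔inside∣≡1+∣p∣ p (x∉p ∘ there)

p⊆q∧∣q∣≤∣p∣⇒q⊆p : ∀ {n} {p q : Subset n} → p ⊆ q → ∣ q ∣ ≤ ∣ p ∣ → q ⊆ p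
p⊆q∧∣q∣≤∣p∣⇒q⊆p {p = p} p⊆q ∣q∣≤∣p∣ {x} x∈q with x ∈? p
... | yes x∈p = x∈p
... | no x∉p = ⊥-elim (<-irrefl refl (<-≤-trans (p⊂q⇒∣p∣<∣q∣ (p⊆q , x , x∈q , x∉p)) ∣q∣≤∣p∣))

Clique : ∀ {n} → Graph n → Subset n → Set
Clique G S = ∀ {x y} → x ∈ S → y ∈ S → x ≢ y → G x y

module _ {n : ℕ} {G : Graph n} where

  complement-sym : Symmetric G → Symmetric (complement G)
  complement-sym G-sym (x≢y , ¬Gxy) = x≢y ∘ sym , λ Gyx → ¬Gxy (G-sym Gyx)

  clique⇒independent : ∀ {S} → Clique G S → Independent (complement G) S
  clique⇒independent cl x y x∈S y∈S (x≢y , ¬Gxy) = ¬Gxy (cl x∈S y∈S x≢y)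

  independent⇒clique : Decidable G → ∀ {S} → Independent (complement G) S → Clique G S
  independent⇒clique G? ind {x} {y} x∈S y∈S x≢y =
    decidable-stable (G? x y) (λ ¬Gxy → ind x y x∈S y∈S (x≢y , ¬Gxy))

  clique-extend : Symmetric G → ∀ {S x} → Clique G S → (∀ {y} → y ∈ S → G x y) →
    Clique G (S [ x ]≔ inside)
  clique-extend G-sym cl x~S y∈ z∈ y≢z with ∈-[]≔inside⁻ y∈ | ∈-[]≔inside⁻ z∈
  ... | inj₁ refl | inj₁ refl = ⊥-elim (y≢z refl)
  ... | inj₁ refl | inj₂ z∈S = x~S z∈S
  ... | inj₂ y∈S | inj₁ refl = G-sym (x~S y∈S)
  ... | inj₂ y∈S | inj₂ z∈S = cl y∈S z∈S y≢z

  Jump⇒≢ : ∀ {X Y} → Jump G X Y → X ≢ Y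
  Jump⇒≢ (u , v , u∈X , v∉X , _ , Y≡) refl with ∈-swap⁻ (subst (u ∈_) Y≡ u∈X)
  ... | inj₁ refl = v∉X u∈X
  ... | inj₂ (u≢u , _) = u≢u refl

  Jump-sym : Symmetric G → ∀ {X Y} → Jump G X Y → Jump G Y X
  Jump-sym G-sym {X} (u , v , u∈X , v∉X , Guv , refl) =
    v , u , []≔-updates _ v , u∉Y , G-sym Guv , ⊆-antisym X⊆ ⊆X
    where
    u∉Y : u ∉ (X [ u ]≔ outside) [ v ]≔ inside
    u∉Y u∈Y with ∈-swap⁻ u∈Y
    ... | inj₁ refl = v∉X u∈X
    ... | inj₂ (u≢u , _) = u≢u refl
    X⊆ : X ⊆ (((X [ u ]≔ outside) [ v ]≔ inside) [ v ]≔ outside) [ u ]≔ inside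
    X⊆ {x} x∈X with x ≟ᶠ u
    ... | yes x≡u = ∈-swap⁺ (inj₁ x≡u)
    ... | no x≢u = ∈-swap⁺ (inj₂ ((λ { refl → v∉X x∈X }) , ∈-swap⁺ (inj₂ (x≢u , x∈X))))
    ⊆X : (((X [ u ]≔ outside) [ v ]≔ inside) [ v ]≔ outside) [ u ]≔ inside ⊆ X
    ⊆X x∈ with ∈-swap⁻ x∈
    ... | inj₁ refl = u∈X
    ... | inj₂ (x≢v , x∈Y) with ∈-swap⁻ x∈Y
    ...   | inj₁ x≡v = ⊥-elim (x≢v x≡v)
    ...   | inj₂ (_ , x∈X) = x∈X

module CliqueCover {n m : ℕ} {G : Graph n} (G? : Decidable G) (G-sym : Symmetric G)
  (C : Fin m → Subset n) {c : ℕ} (∣C∣≡c : ∀ a → ∣ C a ∣ ≡ c)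
  (C-clique : ∀ a → Clique G (C a)) (C-cover : ∀ {T} → Clique G T → ∃ λ a → T ⊆ C a) where

  ∣C∣-const : ∀ a b → ∣ C a ∣ ≡ ∣ C b ∣
  ∣C∣-const a b = trans (∣C∣≡c a) (sym (∣C∣≡c b))

  independent⇒⊆C : ∀ {T} → Independent (complement G) T → ∃ λ a → T ⊆ C a
  independent⇒⊆C = C-cover ∘ independent⇒clique G?

  C-independent : ∀ a → Independent (complement G) (C a)
  C-independent a = clique⇒independent (C-clique a)

  -- A vertex adjacent to all of C a would extend it to a clique that no C b can contain.
  C-dominating : ∀ a → Dominating (complement G) (C a)
  C-dominating a x with x ∈? C a
  ... | yes x∈C = inj₁ x∈C
  ... | no x∉C with any? (λ y → (y ∈? C a) ×-dec ¬? (G? x y))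
  ...   | yes (y , y∈C , ¬Gxy) = inj₂ (y , y∈C , (λ { refl → x∉C y∈C }) , ¬Gxy)
  ...   | no ∄ = ⊥-elim (x∉C (ext⊆C ([]≔-updates (C a) x)))
    where
    x~C : ∀ {y} → y ∈ C a → G x y
    x~C {y} y∈C = decidable-stable (G? x y) (λ ¬Gxy → ∄ (y , y∈C , ¬Gxy))
    C⊆ext : C a ⊆ C a [ x ]≔ inside
    C⊆ext {y} y∈C = []≔-minimal (C a) y x (λ { refl → x∉C y∈C }) y∈C
    ext⊆C : C a [ x ]≔ inside ⊆ C a
    ext⊆C with C-cover (clique-extend G-sym (C-clique a) x~C)
    ... | b , ext⊆Cb =
      p⊆q∧∣q∣≤∣p∣⇒q⊆p C⊆ext (≤-trans (p⊆q⇒∣p∣≤∣q∣ ext⊆Cb) (≤-reflexive (∣C∣-const b a)))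

  dominating-⊆C⇒C⊆ : ∀ {a T} → Dominating (complement G) T → T ⊆ C a → C a ⊆ T
  dominating-⊆C⇒C⊆ {a} dom T⊆C {x} x∈C with dom x
  ... | inj₁ x∈T = x∈T
  ... | inj₂ (y , y∈T , x≢y , ¬Gxy) = ⊥-elim (¬Gxy (C-clique a x∈C (T⊆C y∈T) x≢y))

  independent∧dominating⇒C : ∀ {T} → Independent (complement G) T → Dominating (complement G) T →
    ∃ λ a → C a ≡ T
  independent∧dominating⇒C ind dom with independent⇒⊆C ind
  ... | a , T⊆C = a , ⊆-antisym (dominating-⊆C⇒C⊆ dom T⊆C) T⊆C

  C-isISet : ∀ a → IsISet (complement G) (C a)
  C-isISet a = C-independent a , C-dominating a , minimum
    where
    minimum : ∀ T → Independent (complement G) T → Dominating (complement G) T → ∣ C a ∣ ≤ ∣ T ∣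
    minimum T ind dom with independent∧dominating⇒C ind dom
    ... | b , refl = ≤-reflexive (∣C∣-const a b)

  isISet⇒C : ∀ S → IsISet (complement G) S → ∃ λ a → C a ≡ S
  isISet⇒C S (ind , dom , _) = independent∧dominating⇒C ind dom

  C-isAlphaSet : ∀ a → IsAlphaSet (complement G) (C a)
  C-isAlphaSet a = C-independent a , maximum
    where
    maximum : ∀ T → Independent (complement G) T → ∣ T ∣ ≤ ∣ C a ∣
    maximum T ind with independent⇒⊆C ind
    ... | b , T⊆C = ≤-trans (p⊆q⇒∣p∣≤∣q∣ T⊆C) (≤-reflexive (∣C∣-const b a))

  isAlphaSet⇒C : ∀ S → IsAlphaSet (complement G) S → ∃ λ a → C a ≡ S
  isAlphaSet⇒C S (ind , max) with independent⇒⊆C ind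
  ... | b , S⊆C = b , ⊆-antisym (p⊆q∧∣q∣≤∣p∣⇒q⊆p S⊆C (max (C b) (C-independent b))) S⊆C

CycSucc : ℕ → ℕ → ℕ → Set
CycSucc k a b = b ≡ ℕ.suc a ⊎ (b ≡ 0 × ℕ.suc a ≡ k)

CycSucc-functional : ∀ {k a b b′} → b < k → b′ < k → CycSucc k a b → CycSucc k a b′ → b ≡ b′
CycSucc-functional _ _ (inj₁ refl) (inj₁ refl) = refl
CycSucc-functional b<k _ (inj₁ refl) (inj₂ (refl , refl)) = ⊥-elim (<-irrefl refl b<k)
CycSucc-functional _ b′<k (inj₂ (refl , refl)) (inj₁ refl) = ⊥-elim (<-irrefl refl b′<k)
CycSucc-functional _ _ (inj₂ (refl , _)) (inj₂ (refl , _)) = refl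

CycSucc-injective : ∀ {k a a′ b} → CycSucc k a b → CycSucc k a′ b → a ≡ a′
CycSucc-injective (inj₁ refl) (inj₁ refl) = refl
CycSucc-injective (inj₂ (refl , refl)) (inj₂ (refl , refl)) = refl

CycSucc-irreflexive : ∀ {k a} → 2 ≤ k → ¬ CycSucc k a a
CycSucc-irreflexive _ (inj₁ ())
CycSucc-irreflexive (s≤s (s≤s _)) (inj₂ (refl , ()))

CycSucc-no-2-cycle : ∀ {k a b} → 3 ≤ k → CycSucc k a b → ¬ CycSucc k b a
CycSucc-no-2-cycle _ (inj₁ refl) (inj₁ ())
CycSucc-no-2-cycle (s≤s (s≤s ())) (inj₁ refl) (inj₂ (refl , refl))
CycSucc-no-2-cycle (s≤s (s≤s ())) (inj₂ (refl , refl)) (inj₁ refl)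

CycSucc-no-3-cycle : ∀ {k a b c} → 4 ≤ k → CycSucc k a b → CycSucc k b c → ¬ CycSucc k c a
CycSucc-no-3-cycle _ (inj₁ refl) (inj₁ refl) (inj₁ ())
CycSucc-no-3-cycle (s≤s (s≤s (s≤s ()))) (inj₁ refl) (inj₁ refl) (inj₂ (refl , refl))
CycSucc-no-3-cycle (s≤s (s≤s (s≤s ()))) (inj₁ refl) (inj₂ (refl , refl)) (inj₁ refl)
CycSucc-no-3-cycle (s≤s (s≤s (s≤s ()))) (inj₂ (refl , refl)) (inj₁ refl) (inj₁ refl)

cycleAdj-sym : ∀ {k} → Symmetric (cycleAdj k)
cycleAdj-sym (inj₁ e) = inj₂ (inj₁ e)
cycleAdj-sym (inj₂ (inj₁ e)) = inj₁ e
cycleAdj-sym (inj₂ (inj₂ (inj₁ e))) = inj₂ (inj₂ (inj₂ e))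
cycleAdj-sym (inj₂ (inj₂ (inj₂ e))) = inj₂ (inj₂ (inj₁ e))

CycSucc⇒cycleAdj : ∀ {k} {i j : Fin k} → CycSucc k (toℕ i) (toℕ j) → cycleAdj k i j
CycSucc⇒cycleAdj (inj₁ e) = inj₁ e
CycSucc⇒cycleAdj (inj₂ e) = inj₂ (inj₂ (inj₂ e))

cycleAdj⇒CycSucc : ∀ {k} {i j : Fin k} → cycleAdj k i j →
  CycSucc k (toℕ i) (toℕ j) ⊎ CycSucc k (toℕ j) (toℕ i)
cycleAdj⇒CycSucc (inj₁ e) = inj₁ (inj₁ e)
cycleAdj⇒CycSucc (inj₂ (inj₁ e)) = inj₂ (inj₁ e)
cycleAdj⇒CycSucc (inj₂ (inj₂ (inj₁ e))) = inj₂ (inj₂ e)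
cycleAdj⇒CycSucc (inj₂ (inj₂ (inj₂ e))) = inj₁ (inj₂ e)

cycleAdj? : ∀ k → Decidable (cycleAdj k)
cycleAdj? k i j = (toℕ j ℕ.≟ ℕ.suc (toℕ i)) ⊎-dec (toℕ i ℕ.≟ ℕ.suc (toℕ j))
  ⊎-dec ((toℕ i ℕ.≟ 0) ×-dec (ℕ.suc (toℕ j) ℕ.≟ k))
  ⊎-dec ((toℕ j ℕ.≟ 0) ×-dec (ℕ.suc (toℕ i) ℕ.≟ k))

module _ {n : ℕ} where

  next : Fin (ℕ.suc n) → Fin (ℕ.suc n)
  next i with n ℕ.≟ toℕ i
  ... | yes _ = zero
  ... | no n≢i = suc (lower₁ i n≢i)

  CycSucc-next : ∀ i → CycSucc (ℕ.suc n) (toℕ i) (toℕ (next i))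
  CycSucc-next i with n ℕ.≟ toℕ i
  ... | yes n≡i = inj₂ (refl , cong ℕ.suc (sym n≡i))
  ... | no n≢i = inj₁ (cong ℕ.suc (toℕ-lower₁ i n≢i))

  cycleAdj-next : ∀ i → cycleAdj (ℕ.suc n) i (next i)
  cycleAdj-next i = CycSucc⇒cycleAdj (CycSucc-next i)

  next-unique : ∀ {i j} → CycSucc (ℕ.suc n) (toℕ i) (toℕ j) → j ≡ next i
  next-unique {i} {j} s = toℕ-injective (CycSucc-functional (toℕ<n j) (toℕ<n (next i)) s (CycSucc-next i))

  cycleAdj⇒next : ∀ {i j} → cycleAdj (ℕ.suc n) i j → j ≡ next i ⊎ i ≡ next j
  cycleAdj⇒next adj with cycleAdj⇒CycSucc adj
  ... | inj₁ s = inj₁ (next-unique s)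
  ... | inj₂ s = inj₂ (next-unique s)

  CycSucc-next≡ : ∀ {i j} → next i ≡ j → CycSucc (ℕ.suc n) (toℕ i) (toℕ j)
  CycSucc-next≡ refl = CycSucc-next _

  next-injective : ∀ {i j} → next i ≡ next j → i ≡ j
  next-injective {i} e = toℕ-injective (CycSucc-injective (CycSucc-next i) (CycSucc-next≡ (sym e)))

  next-irreflexive : 2 ≤ ℕ.suc n → ∀ i → next i ≢ i
  next-irreflexive 2≤k i e = CycSucc-irreflexive 2≤k (CycSucc-next≡ e)

  next²-irreflexive : 3 ≤ ℕ.suc n → ∀ i → next (next i) ≢ i
  next²-irreflexive 3≤k i e = CycSucc-no-2-cycle 3≤k (CycSucc-next i) (CycSucc-next≡ e)

  next³-irreflexive : 4 ≤ ℕ.suc n → ∀ i → next (next (next i)) ≢ i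
  next³-irreflexive 4≤k i e =
    CycSucc-no-3-cycle 4≤k (CycSucc-next i) (CycSucc-next (next i)) (CycSucc-next≡ e)

  -- Orient each edge along next: two edges leaving or entering one vertex coincide,
  -- and a directed triangle would be a cycle of length 3.
  cycle-triangleFree : 4 ≤ ℕ.suc n → ∀ {i j l} →
    cycleAdj (ℕ.suc n) i j → cycleAdj (ℕ.suc n) j l → ¬ cycleAdj (ℕ.suc n) i l
  cycle-triangleFree 4≤k ij jl il = oriented (cycleAdj⇒next ij) (cycleAdj⇒next jl) (cycleAdj⇒next il)
    where
    irr : ∀ i → next i ≢ i
    irr = next-irreflexive (≤-trans (s≤s (s≤s z≤n)) 4≤k)
    oriented : ∀ {i j l} → j ≡ next i ⊎ i ≡ next j → l ≡ next j ⊎ j ≡ next l → l ≡ next i ⊎ i ≡ next l → ⊥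
    oriented (inj₁ refl) (inj₁ refl) (inj₁ e) = irr _ (next-injective e)
    oriented (inj₁ refl) (inj₁ refl) (inj₂ e) = next³-irreflexive 4≤k _ (sym e)
    oriented (inj₁ refl) (inj₂ e) (inj₁ refl) = irr _ (sym e)
    oriented (inj₁ refl) (inj₂ e) (inj₂ refl) = irr _ e
    oriented (inj₂ refl) (inj₁ refl) (inj₁ e) = irr _ (sym e)
    oriented (inj₂ refl) (inj₁ refl) (inj₂ e) = irr _ (sym e)
    oriented (inj₂ refl) (inj₂ refl) (inj₁ e) = next³-irreflexive 4≤k _ (sym e)
    oriented (inj₂ refl) (inj₂ refl) (inj₂ e) = irr _ e

wheel-sym : ∀ {k} → Symmetric (wheel k)
wheel-sym {x = zero} {zero} ()
wheel-sym {x = zero} {suc _} _ = tt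
wheel-sym {x = suc _} {zero} _ = tt
wheel-sym {x = suc _} {suc _} adj = cycleAdj-sym adj

wheel? : ∀ k → Decidable (wheel k)
wheel? k zero zero = no λ ()
wheel? k zero (suc _) = yes tt
wheel? k (suc _) zero = yes tt
wheel? k (suc i) (suc j) = cycleAdj? k i j

module WheelComplement {n : ℕ} (4≤k : 4 ≤ ℕ.suc n) where

  k : ℕ
  k = ℕ.suc n

  2≤k : 2 ≤ k
  2≤k = ≤-trans (s≤s (s≤s z≤n)) 4≤k

  3≤k : 3 ≤ k
  3≤k = ≤-trans (s≤s (s≤s (s≤s z≤n))) 4≤k

  triangle : Fin k → Subset (ℕ.suc k)
  triangle a = inside ∷ (⁅ a ⁆ [ next a ]≔ inside)

  hub∈triangle : ∀ {a} → zero ∈ triangle a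
  hub∈triangle = here

  a∈triangle : ∀ a → suc a ∈ triangle a
  a∈triangle a = there ([]≔-minimal ⁅ a ⁆ a (next a) (next-irreflexive 2≤k a ∘ sym) (x∈⁅x⁆ a))

  next∈triangle : ∀ a → suc (next a) ∈ triangle a
  next∈triangle a = there ([]≔-updates ⁅ a ⁆ (next a))

  ∈triangle⁻ : ∀ {a x} → x ∈ triangle a → x ≡ zero ⊎ x ≡ suc a ⊎ x ≡ suc (next a)
  ∈triangle⁻ here = inj₁ refl
  ∈triangle⁻ {a} (there x∈) with ∈-[]≔inside⁻ x∈
  ... | inj₁ refl = inj₂ (inj₂ refl)
  ... | inj₂ x∈⁅a⁆ = inj₂ (inj₁ (cong suc (x∈⁅y⁆⇒x≡y a x∈⁅a⁆)))

  ∣triangle∣≡3 : ∀ a → ∣ triangle a ∣ ≡ 3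
  ∣triangle∣≡3 a = cong ℕ.suc (trans (∣p[x]≔inside∣≡1+∣p∣ ⁅ a ⁆ next∉⁅a⁆) (cong ℕ.suc (∣⁅x⁆∣≡1 a)))
    where
    next∉⁅a⁆ : next a ∉ ⁅ a ⁆
    next∉⁅a⁆ = next-irreflexive 2≤k a ∘ x∈⁅y⁆⇒x≡y a

  triangle-clique : ∀ a → Clique (wheel k) (triangle a)
  triangle-clique a x∈ y∈ = clique (∈triangle⁻ x∈) (∈triangle⁻ y∈)
    where
    clique : ∀ {x y} → x ≡ zero ⊎ x ≡ suc a ⊎ x ≡ suc (next a) →
      y ≡ zero ⊎ y ≡ suc a ⊎ y ≡ suc (next a) → x ≢ y → wheel k x y
    clique (inj₁ refl) (inj₁ refl) x≢y = ⊥-elim (x≢y refl)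
    clique (inj₁ refl) (inj₂ (inj₁ refl)) _ = tt
    clique (inj₁ refl) (inj₂ (inj₂ refl)) _ = tt
    clique (inj₂ (inj₁ refl)) (inj₁ refl) _ = tt
    clique (inj₂ (inj₁ refl)) (inj₂ (inj₁ refl)) x≢y = ⊥-elim (x≢y refl)
    clique (inj₂ (inj₁ refl)) (inj₂ (inj₂ refl)) _ = cycleAdj-next a
    clique (inj₂ (inj₂ refl)) (inj₁ refl) _ = tt
    clique (inj₂ (inj₂ refl)) (inj₂ (inj₁ refl)) _ = cycleAdj-sym (cycleAdj-next a)
    clique (inj₂ (inj₂ refl)) (inj₂ (inj₂ refl)) x≢y = ⊥-elim (x≢y refl)

  rim-adjacent : ∀ {T i j} → Clique (wheel k) T → suc i ∈ T → suc j ∈ T → i ≢ j → cycleAdj k i j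
  rim-adjacent cl i∈T j∈T i≢j = cl i∈T j∈T (i≢j ∘ suc-injective)

  edge-clique⊆triangle : ∀ {T} a → Clique (wheel k) T → suc a ∈ T → suc (next a) ∈ T → T ⊆ triangle a
  edge-clique⊆triangle a cl a∈T next∈T {zero} _ = hub∈triangle
  edge-clique⊆triangle a cl a∈T next∈T {suc x} x∈T with x ≟ᶠ a | x ≟ᶠ next a
  ... | yes refl | _ = a∈triangle a
  ... | _ | yes refl = next∈triangle a
  ... | no x≢a | no x≢next =
    ⊥-elim (cycle-triangleFree 4≤k (rim-adjacent cl x∈T a∈T x≢a) (cycleAdj-next a)
                                   (rim-adjacent cl x∈T next∈T x≢next))

  -- A clique meets the rim in at most an edge: none, one vertex, or two adjacent ones.
  clique⊆triangle : ∀ {T} → Clique (wheel k) T → ∃ λ a → T ⊆ triangle a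
  clique⊆triangle {T} cl with any? (λ j → suc j ∈? T)
  ... | no ∄rim = zero , T⊆
    where
    T⊆ : T ⊆ triangle zero
    T⊆ {zero} _ = hub∈triangle
    T⊆ {suc j} j∈T = ⊥-elim (∄rim (j , j∈T))
  ... | yes (j , j∈T) with any? (λ i → ¬? (i ≟ᶠ j) ×-dec (suc i ∈? T))
  ...   | no ∄other = j , T⊆
    where
    T⊆ : T ⊆ triangle j
    T⊆ {zero} _ = hub∈triangle
    T⊆ {suc i} i∈T with i ≟ᶠ j
    ... | yes refl = a∈triangle i
    ... | no i≢j = ⊥-elim (∄other (i , i≢j , i∈T))
  ...   | yes (i , i≢j , i∈T) with cycleAdj⇒next (rim-adjacent cl i∈T j∈T i≢j)
  ...     | inj₁ refl = i , edge-clique⊆triangle i cl i∈T j∈T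
  ...     | inj₂ refl = j , edge-clique⊆triangle j cl j∈T i∈T

  rim∈triangle⁻ : ∀ {a x} → suc x ∈ triangle a → x ≡ a ⊎ x ≡ next a
  rim∈triangle⁻ x∈ with ∈triangle⁻ x∈
  ... | inj₂ (inj₁ e) = inj₁ (suc-injective e)
  ... | inj₂ (inj₂ e) = inj₂ (suc-injective e)

  triangle-injective : ∀ {i j} → triangle i ≡ triangle j → i ≡ j
  triangle-injective {i} {j} e with rim∈triangle⁻ (subst (suc i ∈_) e (a∈triangle i))
                                  | rim∈triangle⁻ (subst (suc j ∈_) (sym e) (a∈triangle j))
  ... | inj₁ i≡j | _ = i≡j
  ... | _ | inj₁ j≡i = sym j≡i
  ... | inj₂ refl | inj₂ j≡next²j = ⊥-elim (next²-irreflexive 3≤k j (sym j≡next²j))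

  shared-rim⇒cycleAdj : ∀ {i j w} → i ≢ j → suc w ∈ triangle i → suc w ∈ triangle j → cycleAdj k i j
  shared-rim⇒cycleAdj {i} {j} i≢j w∈i w∈j with rim∈triangle⁻ w∈i | rim∈triangle⁻ w∈j
  ... | inj₁ refl | inj₁ refl = ⊥-elim (i≢j refl)
  ... | inj₁ refl | inj₂ refl = cycleAdj-sym (cycleAdj-next j)
  ... | inj₂ refl | inj₁ refl = cycleAdj-next i
  ... | inj₂ w≡next-i | inj₂ w≡next-j = ⊥-elim (i≢j (next-injective (trans (sym w≡next-i) w≡next-j)))

  Gᶜ : Graph (ℕ.suc k)
  Gᶜ = complement (wheel k)

  Gᶜ-sym : Symmetric Gᶜ
  Gᶜ-sym = complement-sym wheel-sym

  jump-next : ∀ i → Jump Gᶜ (triangle i) (triangle (next i))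
  jump-next i = suc i , suc (next (next i)) , a∈triangle i , next²∉ ,
    (next²-irreflexive 3≤k i ∘ sym ∘ suc-injective ,
     cycle-triangleFree 4≤k (cycleAdj-next i) (cycleAdj-next (next i))) ,
    ⊆-antisym ⊆swap swap⊆
    where
    next²∉ : suc (next (next i)) ∉ triangle i
    next²∉ x∈ with rim∈triangle⁻ x∈
    ... | inj₁ e = next²-irreflexive 3≤k i e
    ... | inj₂ e = next-irreflexive 2≤k (next i) e
    swapped : Subset (ℕ.suc k)
    swapped = (triangle i [ suc i ]≔ outside) [ suc (next (next i)) ]≔ inside
    into : ∀ {x} → x ≡ suc (next (next i)) ⊎ (x ≢ suc i × x ∈ triangle i) → x ∈ swapped
    into = ∈-swap⁺
    ⊆swap : triangle (next i) ⊆ swapped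
    ⊆swap x∈ with ∈triangle⁻ x∈
    ... | inj₁ refl = into (inj₂ ((λ ()) , hub∈triangle))
    ... | inj₂ (inj₁ refl) = into (inj₂ (next-irreflexive 2≤k i ∘ suc-injective , next∈triangle i))
    ... | inj₂ (inj₂ refl) = into (inj₁ refl)
    swap⊆ : swapped ⊆ triangle (next i)
    swap⊆ x∈ with ∈-swap⁻ {p = triangle i} {suc i} {suc (next (next i))} x∈
    ... | inj₁ refl = next∈triangle (next i)
    ... | inj₂ (x≢i , x∈) with ∈triangle⁻ x∈
    ...   | inj₁ refl = hub∈triangle
    ...   | inj₂ (inj₁ refl) = ⊥-elim (x≢i refl)
    ...   | inj₂ (inj₂ refl) = a∈triangle (next i)

  cycleAdj⇒jump : ∀ {i j} → cycleAdj k i j → Jump Gᶜ (triangle i) (triangle j)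
  cycleAdj⇒jump {i} {j} adj with cycleAdj⇒next adj
  ... | inj₁ refl = jump-next i
  ... | inj₂ refl = Jump-sym Gᶜ-sym (jump-next j)

  hub-adjacent : ∀ {v} → zero ≢ v → wheel k zero v
  hub-adjacent {zero} 0≢0 = ⊥-elim (0≢0 refl)
  hub-adjacent {suc _} _ = tt

  jump⇒cycleAdj : ∀ {i j} → Jump Gᶜ (triangle i) (triangle j) → cycleAdj k i j
  jump⇒cycleAdj {i} jmp@(u , _ , u∈X , _ , (u≢v , ¬Wuv) , Y≡) with ∈triangle⁻ u∈X
  ... | inj₁ refl = ⊥-elim (¬Wuv (hub-adjacent u≢v))
  ... | inj₂ (inj₁ refl) = shared-rim⇒cycleAdj (Jump⇒≢ jmp ∘ cong triangle) (next∈triangle i)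
        (swap-keeps Y≡ (next-irreflexive 2≤k i ∘ suc-injective) (next∈triangle i))
  ... | inj₂ (inj₂ refl) = shared-rim⇒cycleAdj (Jump⇒≢ jmp ∘ cong triangle) (a∈triangle i)
        (swap-keeps Y≡ (next-irreflexive 2≤k i ∘ sym ∘ suc-injective) (a∈triangle i))

  open CliqueCover (wheel? k) wheel-sym triangle ∣triangle∣≡3 triangle-clique clique⊆triangle

  triangles≅cycle : ∀ {P} → (∀ a → P (triangle a)) → (∀ S → P S → ∃ λ a → triangle a ≡ S) →
    IsoTo (cycleAdj k) P (Jump Gᶜ)
  triangles≅cycle P-triangle P⇒triangle =
    triangle , P-triangle , (λ _ _ → triangle-injective) , P⇒triangle , λ _ _ → cycleAdj⇒jump , jump⇒cycleAdj

  iSets≅cycle : IsoTo (cycleAdj k) (IsISet Gᶜ) (Jump Gᶜ)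
  iSets≅cycle = triangles≅cycle C-isISet isISet⇒C

  αSets≅cycle : IsoTo (cycleAdj k) (IsAlphaSet Gᶜ) (Jump Gᶜ)
  αSets≅cycle = triangles≅cycle C-isAlphaSet isAlphaSet⇒C

mainTheorem13 : (k : ℕ) → 4 ≤ k →
    IsoTo (cycleAdj k) (IsISet (complement (wheel k))) (Jump (complement (wheel k)))
    × IsoTo (cycleAdj k) (IsAlphaSet (complement (wheel k))) (Jump (complement (wheel k)))
mainTheorem13 (ℕ.suc n) 4≤k = iSets≅cycle , αSets≅cycle
  where open WheelComplement 4≤k
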